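{- Let $X=x_0x_1\dots x_k$ be a simple expression of length $k+1$ with $\mathrm{SAT}(X)=x_0'x_1'\dots x_k'$ and $x_0,x_0'\in\Sigma$. Let $Y=y_0\alpha_1y_1\alpha_2\dots\alpha_ky_k$ be a simple expression (where $y_i$ are single positions and the $\alpha_i$ are possibly empty sequences of positions) with $\mathrm{SAT}(Y)=y_0'\alpha_1'y_1'\alpha_2'\dots\alpha_k'y_k'$ (position-wise corresponding) and $y_0,y_0'\in\Sigma$. If $\hat x_i\subseteq\hat y_i$ for all $i\le k$, then $\hat x_i'\subseteq\hat y_i'$ for all $i\le k$.
   Context: Fix a non-consuming TPN with places $P$ and largest guard constant $c_{\max}$; $\Sigma=2^{P\times\{0,\dots,c_{\max}+1\}}$, ordered by $\subseteq$. A simple expression is $E=x_0\dots x_k$ where each $x_i\in\Sigma$ or $x_i=y_i^*$ with $y_i\in\Sigma$ ($x_i$ carries a star); $\hat x_i$ is $x_i$ resp. $y_i$. Fix functions $f,g:\Sigma^3\to\Sigma$ that are monotone w.r.t. $\subseteq$ in each argument and satisfy $f(\alpha,\beta,x)\supseteq x$, $g(\alpha,\beta,x)\supseteq x$ (as provided for the net by the saturation lemma). For a simple expression $E=x_0\dots x_k$ with $x_0\in\Sigma$, put $\alpha=x_0$, $\beta=\bigcup_{i>0}\hat x_i$ and define $\mathrm{SAT}(E)=x_0'\dots x_k'$ where $x_0'=f(\alpha,\beta,x_0)$ and for $i>0$, $\hat x_i'=g(\alpha,\beta,\hat x_i)$, with $x_i'$ starred iff $x_i$ is. -}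

module Defs where

open import Data.Nat using (ℕ; suc; _*_; _<_)
open import Data.Bool using (Bool)
open import Data.Product using (_×_; _,_; proj₁; proj₂)
open import Data.Fin using (Fin) renaming (_<_ to _<ᶠ_)
open import Data.Fin.Subset using (Subset; _⊆_; _∪_; ⋃)
open import Data.Vec using (Vec; map; toList; lookup)

-- The alphabet Σ = 2^(P × {0,…,cmax+1}) for a net with p places and
-- largest guard constant cmax.
Sig : ℕ → ℕ → Set
Sig p cmax = Subset (p * suc (suc cmax))

-- A position of a simple expression: a flag "carries a star" and the
-- underlying letter x̂ ∈ Σ (x itself if unstarred, y if x = y*).
record Letter (p cmax : ℕ) : Set where
  constructor mkLetter
  field
    starred : Bool
    hat     : Sig p cmax
open Letter public

-- A simple expression x₀ x₁ … x_k whose first position x₀ is in Σ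
-- (unstarred): head x₀ and the tail x₁ … x_k.
record SExpr (p c k : ℕ) : Set where
  constructor _◂_
  field
    hd : Sig p c
    tl : Vec (Letter p c) k
open SExpr public

Monotone3 : ∀ p c → (Sig p c → Sig p c → Sig p c → Sig p c) → Set
Monotone3 p c h = ∀ (a a' b b' x x' : Sig p c) →
  a ⊆ a' → b ⊆ b' → x ⊆ x' → h a b x ⊆ h a' b' x'

Extensive3 : ∀ p c → (Sig p c → Sig p c → Sig p c → Sig p c) → Set
Extensive3 p c h = ∀ (a b x : Sig p c) → x ⊆ h a b x

betaOf : ∀ {p c k} → SExpr p c k → Sig p c
betaOf E = ⋃ (toList (map hat (tl E)))

SAT : ∀ {p c k} → (f g : Sig p c → Sig p c → Sig p c → Sig p c) →
      SExpr p c k → SExpr p c k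
SAT f g E = f α β (hd E) ◂ map (λ l → mkLetter (starred l) (g α β (hat l))) (tl E)
  where
    α = hd E
    β = betaOf E

StrictlyIncreasing : ∀ {k m} → (Fin k → Fin m) → Set
StrictlyIncreasing {k} ι = ∀ (i j : Fin k) → i <ᶠ j → ι i <ᶠ ι j

module Submission where

-- SAT rewrites every position of E from three data: the head α = x₀, the
-- union β of the tail letters, and the position itself.  If the positions of
-- X are dominated by positions of Y through a map ι (with the heads
-- dominated as well), then
--   (1) β_X ⊆ β_Y, because every tail letter of X lies below some tail
--       letter of Y, hence below the union β_Y (least-upper-bound property
--       of a finite union, `⋃-embed`);
--   (2) each saturated position of X is f or g applied to arguments that are
--       pointwise below those of the corresponding saturated position of Y,
--       so monotonicity of f and g finishes the proof.

open import Defs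
open import Data.Nat using (ℕ)
open import Data.Product using (_×_; _,_)
open import Data.Fin using (Fin; zero; suc)
open import Data.Fin.Subset using (Subset; _⊆_; ⋃)
open import Data.Fin.Subset.Properties using (p⊆p∪q; q⊆p∪q; x∈p∪q⁻; ⊆-trans; ⊥⊆)
open import Data.Sum using (inj₁; inj₂)
open import Data.Vec using (Vec; []; _∷_; lookup; map; toList)
open import Data.Vec.Properties using (lookup-map)
open import Relation.Binary.PropositionalEquality using (_≡_; subst₂; sym; cong)

⋃-upper : ∀ {n k} (v : Vec (Subset n) k) (j : Fin k) → lookup v j ⊆ ⋃ (toList v)
⋃-upper (s ∷ v) zero    = p⊆p∪q (⋃ (toList v))
⋃-upper (s ∷ v) (suc j) = ⊆-trans (⋃-upper v j) (q⊆p∪q s (⋃ (toList v)))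

⋃-least : ∀ {n k} (v : Vec (Subset n) k) (T : Subset n) →
          (∀ j → lookup v j ⊆ T) → ⋃ (toList v) ⊆ T
⋃-least []      T below = ⊥⊆
⋃-least (s ∷ v) T below x∈ with x∈p∪q⁻ s (⋃ (toList v)) x∈
... | inj₁ x∈s  = below zero x∈s
... | inj₂ x∈⋃v = ⋃-least v T (λ j → below (suc j)) x∈⋃v

⋃-embed : ∀ {n k m} (u : Vec (Subset n) k) (w : Vec (Subset n) m)
          (ι : Fin k → Fin m) → (∀ i → lookup u i ⊆ lookup w (ι i)) →
          ⋃ (toList u) ⊆ ⋃ (toList w)
⋃-embed u w ι dom = ⋃-least u (⋃ (toList w)) (λ i → ⊆-trans (dom i) (⋃-upper w (ι i)))

tailHat : ∀ {p c k} → SExpr p c k → Fin k → Sig p c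
tailHat E i = hat (lookup (tl E) i)

betaOf-embed : ∀ {p c k m} (X : SExpr p c k) (Y : SExpr p c m) (ι : Fin k → Fin m) →
               (∀ i → tailHat X i ⊆ tailHat Y (ι i)) → betaOf X ⊆ betaOf Y
betaOf-embed X Y ι dom = ⋃-embed (map hat (tl X)) (map hat (tl Y)) ι domHats
  where
  domHats : ∀ i → lookup (map hat (tl X)) i ⊆ lookup (map hat (tl Y)) (ι i)
  domHats i = subst₂ _⊆_ (sym (lookup-map i hat (tl X)))
                         (sym (lookup-map (ι i) hat (tl Y))) (dom i)

SAT-tailHat : ∀ {p c k} (f g : Sig p c → Sig p c → Sig p c → Sig p c)
              (E : SExpr p c k) (i : Fin k) →
              tailHat (SAT f g E) i ≡ g (hd E) (betaOf E) (tailHat E i)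
SAT-tailHat f g E i =
  cong hat (lookup-map i (λ l → mkLetter (starred l) (g (hd E) (betaOf E) (hat l))) (tl E))

lemma16 : ∀ (p cmax : ℕ)
    (f g : Sig p cmax → Sig p cmax → Sig p cmax → Sig p cmax) →
    Monotone3 p cmax f → Monotone3 p cmax g →
    Extensive3 p cmax f → Extensive3 p cmax g →
    ∀ (k m : ℕ) (X : SExpr p cmax k) (Y : SExpr p cmax m)
    (ι : Fin k → Fin m) → StrictlyIncreasing ι →
    hd X ⊆ hd Y →
    (∀ (i : Fin k) → hat (lookup (tl X) i) ⊆ hat (lookup (tl Y) (ι i))) →
    (hd (SAT f g X) ⊆ hd (SAT f g Y)) ×
    (∀ (i : Fin k) → hat (lookup (tl (SAT f g X)) i) ⊆ hat (lookup (tl (SAT f g Y)) (ι i)))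
lemma16 p cmax f g f-mono g-mono _ _ k m X Y ι _ hd⊆ tail⊆ =
  f-mono (hd X) (hd Y) (betaOf X) (betaOf Y) (hd X) (hd Y) hd⊆ β⊆ hd⊆ , satTail⊆
  where
  β⊆ : betaOf X ⊆ betaOf Y
  β⊆ = betaOf-embed X Y ι tail⊆

  satTail⊆ : ∀ i → tailHat (SAT f g X) i ⊆ tailHat (SAT f g Y) (ι i)
  satTail⊆ i = subst₂ _⊆_ (sym (SAT-tailHat f g X i)) (sym (SAT-tailHat f g Y (ι i)))
                 (g-mono (hd X) (hd Y) (betaOf X) (betaOf Y) _ _ hd⊆ β⊆ (tail⊆ i))
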